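{- Let $G$ be a Laman graph. Suppose $G$ contains a triangle on vertices $u,v,u_1$ such that (1) $\deg_G u=\deg_G v=3$ and $\deg_G u_1>3$; (2) letting $w\in V_G\setminus\{v,u_1\}$ be the third neighbor of $u$ and $u_2\in V_G\setminus\{u,u_1\}$ be the third neighbor of $v$, we have $wu_2\in E_G$; (3) $wu_1\notin E_G$ and $u_1u_2\notin E_G$. Then either there is a Laman graph $G'=(V',E')$ such that $G$ is obtained from $G'$ by a Henneberg move of type IIb adding the vertex $v$ linked to $u,u_1,u_2\in V'$, where $uu_1\in E'$, $uu_2\notin E'$ and the edge $u_1u_2\in E'$ is removed; or, symmetrically, there is a Laman graph $G'=(V',E')$ such that $G$ is obtained from $G'$ by a Henneberg move of type IIb adding the vertex $u$ linked to $v,u_1,w\in V'$, where $vu_1\in E'$, $vw\notin E'$ and the edge $u_1w\in E'$ is removed.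
   Context: Graphs are finite, simple, undirected. A graph $G$ is a Laman graph if $|E_G|=2|V_G|-3$ and every subgraph $H$ with at least two vertices satisfies $|E_H|\le 2|V_H|-3$. A Henneberg move of type II: given a graph $G'=(V',E')$, vertices $u,u_1,u_2\in V'$ with $u_1u_2\in E'$, and a new vertex $v\notin V'$, the graph $G$ has $V_G=V'\cup\{v\}$ and $E_G=(E'\setminus\{u_1u_2\})\cup\{uv,u_1v,u_2v\}$. It is of type IIb if exactly one of $uu_1,uu_2$ lies in $E'$. -}

module Defs where

open import Data.Nat using (ℕ; _+_; _*_; _≤_; _<_)
open import Data.Bool using (Bool; true; false; _∧_; T?)
open import Data.Nat using (_<ᵇ_)
open import Data.Fin using (Fin; toℕ; punchIn)
open import Data.List using (List; []; _∷_; length; filter; allFin; concatMap; map)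
open import Data.Product using (_×_; _,_; Σ; ∃; proj₁; proj₂)
open import Data.Sum using (_⊎_)
open import Relation.Binary.PropositionalEquality using (_≡_)
open import Relation.Nullary using (¬_; Dec)
import Data.Nat as ℕ

record Graph (n : ℕ) : Set where
  field
    adj    : Fin n → Fin n → Bool
    sym    : ∀ x y → adj x y ≡ adj y x
    irrefl : ∀ x → adj x x ≡ false
open Graph public

Edge : ∀ {n} → Graph n → Fin n → Fin n → Set
Edge G x y = adj G x y ≡ true

countV : ∀ {n} → (Fin n → Bool) → ℕ
countV {n} S = length (filter (λ x → T? (S x)) (allFin n))

countE : ∀ {n} → (Fin n → Fin n → Bool) → ℕ
countE {n} F =
  length (filter (λ p → T? ((toℕ (proj₁ p) <ᵇ toℕ (proj₂ p)) ∧ F (proj₁ p) (proj₂ p)))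
    (concatMap (λ x → map (λ y → (x , y)) (allFin n)) (allFin n)))

deg : ∀ {n} → Graph n → Fin n → ℕ
deg G x = countV (adj G x)

record Subgraph {n : ℕ} (G : Graph n) : Set where
  field
    VH      : Fin n → Bool
    EH      : Fin n → Fin n → Bool
    EH-sym  : ∀ x y → EH x y ≡ EH y x
    EH⊆E    : ∀ x y → EH x y ≡ true → adj G x y ≡ true
    EH-endˡ : ∀ x y → EH x y ≡ true → VH x ≡ true
    EH-endʳ : ∀ x y → EH x y ≡ true → VH y ≡ true
open Subgraph public

-- Laman graph: |E| = 2|V| - 3 and every subgraph H with |V_H| ≥ 2 has
-- |E_H| ≤ 2|V_H| - 3 (written with +3 on the left to stay in ℕ).
record Laman {n : ℕ} (G : Graph n) : Set where
  field
    count  : countE (adj G) + 3 ≡ 2 * n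
    sparse : (H : Subgraph G) → 2 ≤ countV (VH H) →
             countE (EH H) + 3 ≤ 2 * countV (VH H)

-- The old graph G' has vertex set Fin m, the new
-- graph G has vertex set Fin (suc m), and the new vertex is v; V' is
-- identified with V_G ∖ {v} via  punchIn v : Fin m → Fin (suc m).
record HennebergII {m : ℕ} (G' : Graph m) (G : Graph (ℕ.suc m))
                   (v : Fin (ℕ.suc m)) (u u₁ u₂ : Fin m) : Set where
  field
    u₁u₂∈E' : Edge G' u₁ u₂
    old     : ∀ x y → (Edge G (punchIn v x) (punchIn v y) →
                         Edge G' x y × ¬ ((x ≡ u₁ × y ≡ u₂) ⊎ (x ≡ u₂ × y ≡ u₁)))
                    × (Edge G' x y × ¬ ((x ≡ u₁ × y ≡ u₂) ⊎ (x ≡ u₂ × y ≡ u₁)) →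
                         Edge G (punchIn v x) (punchIn v y))
    new     : ∀ x → (Edge G v (punchIn v x) → (x ≡ u ⊎ x ≡ u₁ ⊎ x ≡ u₂))
                  × ((x ≡ u ⊎ x ≡ u₁ ⊎ x ≡ u₂) → Edge G v (punchIn v x))

TypeIIb : ∀ {m} → Graph m → Fin m → Fin m → Fin m → Set
TypeIIb G' u u₁ u₂ = (Edge G' u u₁ × ¬ Edge G' u u₂) ⊎ (¬ Edge G' u u₁ × Edge G' u u₂)

-- A vertex set S is tight if it spans 2|S| - 3 edges; it blocks the reduction at a degree-3
-- vertex x towards ab if it is tight, contains a and b and avoids x.  The inverse IIb move
-- (IIb-reduction): if x has degree 3 with neighbours y, a, b, where ya is an edge but ab and yb
-- are not, and no set blocks x towards ab, then G - x + ab is Laman and G arises from it by a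
-- IIb move.  The theorem follows by deciding, by exhaustive search over all vertex sets, whether
-- some A blocks v towards u₁u₂.  If not, reduce at v.  If so, no B blocks u towards u₁w
-- (blockers-incompatible): A ∪ B ∪ {u} would be tight and contain three neighbours of v,
-- contradicting sparsity.  So reduce at u.

module Submission where

open import Defs hiding (sym)
open import Data.Nat using (ℕ; zero; suc; _+_; _*_; _≤_; _<_; _<ᵇ_; _≤?_; z≤n; s≤s)
open import Data.Nat.Tactic.RingSolver using (solve-∀)
open import Data.Nat.Properties
open import Data.Bool using (Bool; true; false; _∧_; _∨_; not; T?) renaming (_≟_ to _≟ᵇ_)
open import Data.Bool.Properties using (∧-zeroʳ; ∨-zeroʳ; ∨-identityʳ; ∧-identityʳ; ∧-comm; ∨-comm; ∧-idem)
open import Data.Fin using (Fin; zero; suc; toℕ; punchIn; punchOut)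
import Data.Fin.Properties as Fin
open import Data.List using (List; []; _∷_; length; filter; allFin; concatMap; map; tabulate; _++_)
import Data.List.Properties as List
open import Data.List.Relation.Unary.All using (All; []; _∷_; zipWith)
open import Data.List.Relation.Unary.Unique.Propositional using (Unique)
open import Data.List.Relation.Unary.AllPairs using ([]; _∷_)
open import Data.Vec.Functional using (Vector; insertAt)
open import Data.Vec.Functional.Properties using (insertAt-lookup; insertAt-punchIn)
import Data.Vec as Vec
open import Data.Vec.Properties using (lookup∘tabulate)
open import Data.Fin.Subset.Properties using (anySubset?)
open import Data.Product using (_×_; _,_; proj₁; proj₂; Σ; ∃-syntax)
open import Data.Sum using (_⊎_; inj₁; inj₂; [_,_]′)
open import Data.Empty using (⊥)
open import Function using (_∘_; id)
open import Relation.Binary.PropositionalEquality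
open import Relation.Nullary using (¬_; Dec; yes; no; does; contradiction)
open import Relation.Nullary.Decidable using (dec-true; dec-false; _×-dec_)
open import Algebra.Properties.CommutativeMonoid.Sum +-0-commutativeMonoid
  using (sum; sum-cong-≗; ∑-distrib-+; sum-remove; sum-replicate-zero)

∧-true : ∀ {a b : Bool} → a ∧ b ≡ true → a ≡ true × b ≡ true
∧-true {true} {true} _ = refl , refl

∨-true : ∀ {a b : Bool} → a ∨ b ≡ true → a ≡ true ⊎ b ≡ true
∨-true {true} _ = inj₁ refl
∨-true {false} b≡true = inj₂ b≡true

∨-introˡ : ∀ {a} b → a ≡ true → a ∨ b ≡ true
∨-introˡ b refl = refl

∨-introʳ : ∀ a {b} → b ≡ true → a ∨ b ≡ true
∨-introʳ a refl = ∨-zeroʳ a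

∧-intro : ∀ {a b : Bool} → a ≡ true → b ≡ true → a ∧ b ≡ true
∧-intro refl b≡true = b≡true

false≢true : false ≢ true
false≢true ()

false-unless-true : ∀ {b} → ¬ (b ≡ true) → b ≡ false
false-unless-true {false} _ = refl
false-unless-true {true} b≢true = contradiction refl b≢true

_==_ : ∀ {n} → Fin n → Fin n → Bool
x == y = does (x Fin.≟ y)

==-refl : ∀ {n} (x : Fin n) → x == x ≡ true
==-refl x = dec-true (x Fin.≟ x) refl

==-≢ : ∀ {n} {x y : Fin n} → x ≢ y → x == y ≡ false
==-≢ {x = x} {y} = dec-false (x Fin.≟ y)

==-sound : ∀ {n} {x y : Fin n} → x == y ≡ true → x ≡ y
==-sound {x = x} {y} x==y with x Fin.≟ y
... | yes x≡y = x≡y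

⟦_⟧ : Bool → ℕ
⟦ true ⟧ = 1
⟦ false ⟧ = 0

sum-mono : ∀ {n} {f g : Vector ℕ n} → (∀ i → f i ≤ g i) → sum f ≤ sum g
sum-mono {zero} f≤g = z≤n
sum-mono {suc n} f≤g = +-mono-≤ (f≤g zero) (sum-mono (f≤g ∘ suc))

VSet : ℕ → Set
VSet n = Fin n → Bool

Rel : ℕ → Set
Rel n = Fin n → Fin n → Bool

SymRel : ∀ {n} → Rel n → Set
SymRel F = ∀ x y → F x y ≡ F y x

∣_∣ᵥ : ∀ {n} → VSet n → ℕ
∣ S ∣ᵥ = sum (λ x → ⟦ S x ⟧)

_<ᶠ_ : ∀ {n} → Fin n → Fin n → Bool
x <ᶠ y = toℕ x <ᵇ toℕ y

∣_∣ₑ : ∀ {n} → Rel n → ℕ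
∣ F ∣ₑ = sum (λ x → sum (λ y → ⟦ x <ᶠ y ∧ F x y ⟧))

length-filter-tabulate : ∀ {A : Set} {n} (b : A → Bool) (g : Fin n → A) →
  length (filter (T? ∘ b) (tabulate g)) ≡ sum (λ i → ⟦ b (g i) ⟧)
length-filter-tabulate {n = zero} b g = refl
length-filter-tabulate {n = suc n} b g with b (g zero)
... | true = cong suc (length-filter-tabulate b (g ∘ suc))
... | false = length-filter-tabulate b (g ∘ suc)

length-filter-concatMap : ∀ {A B : Set} {n} (b : B → Bool) (k : A → List B) (g : Fin n → A) →
  length (filter (T? ∘ b) (concatMap k (tabulate g))) ≡ sum (λ i → length (filter (T? ∘ b) (k (g i))))
length-filter-concatMap {n = zero} b k g = refl
length-filter-concatMap {n = suc n} b k g = begin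
    length (filter (T? ∘ b) (k (g zero) ++ concatMap k (tabulate (g ∘ suc))))
  ≡⟨ cong length (List.filter-++ (T? ∘ b) (k (g zero)) _) ⟩
    length (filter (T? ∘ b) (k (g zero)) ++ filter (T? ∘ b) (concatMap k (tabulate (g ∘ suc))))
  ≡⟨ List.length-++ (filter (T? ∘ b) (k (g zero))) ⟩
    length (filter (T? ∘ b) (k (g zero))) + length (filter (T? ∘ b) (concatMap k (tabulate (g ∘ suc))))
  ≡⟨ cong (length (filter (T? ∘ b) (k (g zero))) +_) (length-filter-concatMap b k (g ∘ suc)) ⟩
    sum (λ i → length (filter (T? ∘ b) (k (g i)))) ∎
  where open ≡-Reasoning

countV≡∣∣ᵥ : ∀ {n} (S : VSet n) → countV S ≡ ∣ S ∣ᵥ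
countV≡∣∣ᵥ S = length-filter-tabulate S id

countE≡∣∣ₑ : ∀ {n} (F : Rel n) → countE F ≡ ∣ F ∣ₑ
countE≡∣∣ₑ {n} F = trans (length-filter-concatMap b row id) (sum-cong-≗ λ x →
    trans (cong (length ∘ filter (T? ∘ b)) (List.map-tabulate id (x ,_)))
          (length-filter-tabulate b (x ,_)))
  where
  b : Fin n × Fin n → Bool
  b (x , y) = x <ᶠ y ∧ F x y
  row : Fin n → List (Fin n × Fin n)
  row x = map (x ,_) (allFin n)

_∪_ _∩_ : ∀ {n} → VSet n → VSet n → VSet n
(A ∪ B) x = A x ∨ B x
(A ∩ B) x = A x ∧ B x

insert delete : ∀ {n} → Fin n → VSet n → VSet n
insert i S x = S x ∨ (x == i)
delete i S x = S x ∧ not (x == i)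

_∨ᵣ_ _∧ᵣ_ : ∀ {n} → Rel n → Rel n → Rel n
(F ∨ᵣ H) x y = F x y ∨ H x y
(F ∧ᵣ H) x y = F x y ∧ H x y

single : ∀ {n} → Fin n → Fin n → Rel n
single a b x y = (x == a ∧ y == b) ∨ (x == b ∧ y == a)

restrict : ∀ {m} → Fin (suc m) → Rel (suc m) → Rel m
restrict i F x y = F (punchIn i x) (punchIn i y)

⟦∧⟧-inclusion-exclusion : ∀ c a b → ⟦ c ∧ a ⟧ + ⟦ c ∧ b ⟧ ≡ ⟦ c ∧ (a ∨ b) ⟧ + ⟦ c ∧ (a ∧ b) ⟧
⟦∧⟧-inclusion-exclusion false a b = refl
⟦∧⟧-inclusion-exclusion true false false = refl
⟦∧⟧-inclusion-exclusion true false true = refl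
⟦∧⟧-inclusion-exclusion true true false = refl
⟦∧⟧-inclusion-exclusion true true true = refl

⟦∧⟧-mono : ∀ c {a b} → (a ≡ true → b ≡ true) → ⟦ c ∧ a ⟧ ≤ ⟦ c ∧ b ⟧
⟦∧⟧-mono false a⇒b = z≤n
⟦∧⟧-mono true {false} a⇒b = z≤n
⟦∧⟧-mono true {true} a⇒b rewrite a⇒b refl = ≤-refl

size-cong : ∀ {n} {S T : VSet n} → (∀ x → S x ≡ T x) → ∣ S ∣ᵥ ≡ ∣ T ∣ᵥ
size-cong S≗T = sum-cong-≗ (cong ⟦_⟧ ∘ S≗T)

edges-cong : ∀ {n} {F H : Rel n} → (∀ x y → F x y ≡ H x y) → ∣ F ∣ₑ ≡ ∣ H ∣ₑ
edges-cong F≗H = sum-cong-≗ λ x → sum-cong-≗ λ y → cong (λ b → ⟦ x <ᶠ y ∧ b ⟧) (F≗H x y)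

edges-mono : ∀ {n} {F H : Rel n} → (∀ x y → F x y ≡ true → H x y ≡ true) → ∣ F ∣ₑ ≤ ∣ H ∣ₑ
edges-mono F⊆H = sum-mono λ x → sum-mono λ y → ⟦∧⟧-mono (x <ᶠ y) (F⊆H x y)

size-inclusion-exclusion : ∀ {n} (A B : VSet n) → ∣ A ∣ᵥ + ∣ B ∣ᵥ ≡ ∣ A ∪ B ∣ᵥ + ∣ A ∩ B ∣ᵥ
size-inclusion-exclusion A B = begin
    ∣ A ∣ᵥ + ∣ B ∣ᵥ
  ≡⟨ ∑-distrib-+ (λ x → ⟦ A x ⟧) (λ x → ⟦ B x ⟧) ⟨
    sum (λ x → ⟦ A x ⟧ + ⟦ B x ⟧)
  ≡⟨ sum-cong-≗ (λ x → ⟦∧⟧-inclusion-exclusion true (A x) (B x)) ⟩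
    sum (λ x → ⟦ (A ∪ B) x ⟧ + ⟦ (A ∩ B) x ⟧)
  ≡⟨ ∑-distrib-+ (λ x → ⟦ (A ∪ B) x ⟧) (λ x → ⟦ (A ∩ B) x ⟧) ⟩
    ∣ A ∪ B ∣ᵥ + ∣ A ∩ B ∣ᵥ ∎
  where open ≡-Reasoning

edges-inclusion-exclusion : ∀ {n} (F H : Rel n) → ∣ F ∣ₑ + ∣ H ∣ₑ ≡ ∣ F ∨ᵣ H ∣ₑ + ∣ F ∧ᵣ H ∣ₑ
edges-inclusion-exclusion F H = begin
    sum (row F) + sum (row H)
  ≡⟨ ∑-distrib-+ (row F) (row H) ⟨
    sum (λ x → row F x + row H x)
  ≡⟨ sum-cong-≗ row-ie ⟩
    sum (λ x → row (F ∨ᵣ H) x + row (F ∧ᵣ H) x)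
  ≡⟨ ∑-distrib-+ (row (F ∨ᵣ H)) (row (F ∧ᵣ H)) ⟩
    ∣ F ∨ᵣ H ∣ₑ + ∣ F ∧ᵣ H ∣ₑ ∎
  where
  open ≡-Reasoning
  cell : Rel _ → Fin _ → Fin _ → ℕ
  cell K x y = ⟦ x <ᶠ y ∧ K x y ⟧
  row : Rel _ → Fin _ → ℕ
  row K x = sum (cell K x)
  row-ie : ∀ x → row F x + row H x ≡ row (F ∨ᵣ H) x + row (F ∧ᵣ H) x
  row-ie x = trans (sym (∑-distrib-+ (cell F x) (cell H x))) (trans
    (sum-cong-≗ (λ y → ⟦∧⟧-inclusion-exclusion (x <ᶠ y) (F x y) (H x y)))
    (∑-distrib-+ (cell (F ∨ᵣ H) x) (cell (F ∧ᵣ H) x)))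

edges-empty : ∀ {n} {F : Rel n} → (∀ x y → F x y ≡ false) → ∣ F ∣ₑ ≡ 0
edges-empty {n} {F} F≡false =
  trans (sum-cong-≗ λ x → trans (sum-cong-≗ λ y → no-edge x y) (sum-replicate-zero n))
        (sum-replicate-zero n)
  where
  no-edge : ∀ x y → ⟦ x <ᶠ y ∧ F x y ⟧ ≡ 0
  no-edge x y rewrite F≡false x y | ∧-zeroʳ (x <ᶠ y) = refl

size-empty : ∀ n → ∣ (λ (_ : Fin n) → false) ∣ᵥ ≡ 0
size-empty n = sum-replicate-zero n

size-split : ∀ {m} (i : Fin (suc m)) (S : VSet (suc m)) → ∣ S ∣ᵥ ≡ ⟦ S i ⟧ + ∣ S ∘ punchIn i ∣ᵥ
size-split i S = sum-remove {i = i} (λ x → ⟦ S x ⟧)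

size-avoiding : ∀ {m} (i : Fin (suc m)) (S : VSet (suc m)) → S i ≡ false → ∣ S ∣ᵥ ≡ ∣ S ∘ punchIn i ∣ᵥ
size-avoiding i S Si≡false = trans (size-split i S) (cong (λ b → ⟦ b ⟧ + ∣ S ∘ punchIn i ∣ᵥ) Si≡false)

size-add-vertex : ∀ {m} (i : Fin (suc m)) {S T : VSet (suc m)} → S i ≡ false → T i ≡ true →
  (∀ y → S (punchIn i y) ≡ T (punchIn i y)) → ∣ T ∣ᵥ ≡ suc ∣ S ∣ᵥ
size-add-vertex i {S} {T} Si≡false Ti≡true S≗T = begin
    ∣ T ∣ᵥ
  ≡⟨ size-split i T ⟩
    ⟦ T i ⟧ + ∣ T ∘ punchIn i ∣ᵥ
  ≡⟨ cong₂ _+_ (cong ⟦_⟧ Ti≡true) (size-cong (sym ∘ S≗T)) ⟩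
    suc ∣ S ∘ punchIn i ∣ᵥ
  ≡⟨ cong (λ b → suc (⟦ b ⟧ + ∣ S ∘ punchIn i ∣ᵥ)) Si≡false ⟨
    suc (⟦ S i ⟧ + ∣ S ∘ punchIn i ∣ᵥ)
  ≡⟨ cong suc (size-split i S) ⟨
    suc ∣ S ∣ᵥ ∎
  where open ≡-Reasoning

insert-self : ∀ {n} (i : Fin n) (S : VSet n) → insert i S i ≡ true
insert-self i S = ∨-introʳ (S i) (==-refl i)

insert-other : ∀ {n} {i y : Fin n} (S : VSet n) → y ≢ i → insert i S y ≡ S y
insert-other {y = y} S y≢i rewrite ==-≢ y≢i = ∨-identityʳ (S y)

delete-self : ∀ {n} (i : Fin n) (S : VSet n) → delete i S i ≡ false
delete-self i S rewrite ==-refl i = ∧-zeroʳ (S i)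

delete-other : ∀ {n} {i y : Fin n} (S : VSet n) → y ≢ i → delete i S y ≡ S y
delete-other {y = y} S y≢i rewrite ==-≢ y≢i = ∧-identityʳ (S y)

size-insert : ∀ {m} (i : Fin (suc m)) (S : VSet (suc m)) → S i ≡ false → ∣ insert i S ∣ᵥ ≡ suc ∣ S ∣ᵥ
size-insert i S Si≡false = size-add-vertex i {S} {insert i S} Si≡false (insert-self i S)
  (λ y → sym (insert-other S (Fin.punchInᵢ≢i i y)))

size-delete : ∀ {m} (i : Fin (suc m)) (S : VSet (suc m)) → S i ≡ true → ∣ S ∣ᵥ ≡ suc ∣ delete i S ∣ᵥ
size-delete i S Si≡true = size-add-vertex i {delete i S} {S} (delete-self i S) Si≡true
  (λ y → delete-other S (Fin.punchInᵢ≢i i y))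

members-≤-size : ∀ {n} (S : VSet n) (xs : List (Fin n)) → Unique xs →
                 All (λ x → S x ≡ true) xs → length xs ≤ ∣ S ∣ᵥ
members-≤-size S [] _ _ = z≤n
members-≤-size {zero} S (() ∷ _) _ _
members-≤-size {suc m} S (x ∷ xs) (x∉xs ∷ xs-unique) (Sx ∷ Sxs) =
  subst (suc (length xs) ≤_) (sym (size-delete x S Sx))
    (s≤s (members-≤-size (delete x S) xs xs-unique (zipWith kept (x∉xs , Sxs))))
  where
  kept : ∀ {y} → x ≢ y × S y ≡ true → delete x S y ≡ true
  kept (x≢y , Sy) = trans (delete-other S (x≢y ∘ sym)) Sy

size-singleton : ∀ {n} (b : Fin n) → ∣ (_== b) ∣ᵥ ≡ 1
size-singleton {suc m} b = trans
  (size-add-vertex b {λ _ → false} {_== b} refl (==-refl b) (λ y → sym (==-≢ (Fin.punchInᵢ≢i b y))))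
  (cong suc (size-empty m))

<ᶠ-irrefl : ∀ {n} (x : Fin n) → x <ᶠ x ≡ false
<ᶠ-irrefl x = <ᵇ-irrefl (toℕ x)
  where
  <ᵇ-irrefl : ∀ k → (k <ᵇ k) ≡ false
  <ᵇ-irrefl zero = refl
  <ᵇ-irrefl (suc k) = <ᵇ-irrefl k

<ᶠ-punchIn : ∀ {m} (i : Fin (suc m)) (x y : Fin m) → punchIn i x <ᶠ punchIn i y ≡ x <ᶠ y
<ᶠ-punchIn zero x y = refl
<ᶠ-punchIn (suc i) zero zero = refl
<ᶠ-punchIn (suc i) zero (suc y) = refl
<ᶠ-punchIn (suc i) (suc x) zero = refl
<ᶠ-punchIn (suc i) (suc x) (suc y) = <ᶠ-punchIn i x y

<ᶠ-either : ∀ {n} (x y : Fin n) c → x ≢ y → ⟦ x <ᶠ y ∧ c ⟧ + ⟦ y <ᶠ x ∧ c ⟧ ≡ ⟦ c ⟧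
<ᶠ-either x y c x≢y = <ᵇ-either (toℕ x) (toℕ y) (x≢y ∘ Fin.toℕ-injective)
  where
  <ᵇ-either : ∀ j k → j ≢ k → ⟦ (j <ᵇ k) ∧ c ⟧ + ⟦ (k <ᵇ j) ∧ c ⟧ ≡ ⟦ c ⟧
  <ᵇ-either zero zero j≢k = contradiction refl j≢k
  <ᵇ-either zero (suc k) j≢k = +-identityʳ ⟦ c ⟧
  <ᵇ-either (suc j) zero j≢k = refl
  <ᵇ-either (suc j) (suc k) j≢k = <ᵇ-either j k (j≢k ∘ cong suc)

edges-split : ∀ {m} (i : Fin (suc m)) (F : Rel (suc m)) → SymRel F →
              ∣ F ∣ₑ ≡ ∣ restrict i F ∣ₑ + ∣ F i ∘ punchIn i ∣ᵥ
edges-split {m} i F F-sym = begin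
    ∣ F ∣ₑ
  ≡⟨ sum-remove {i = i} (λ x → sum (cell x)) ⟩
    sum (cell i) + sum (λ x → sum (cell (p x)))
  ≡⟨ cong₂ _+_ row-i (sum-cong-≗ λ x → sum-remove {i = i} (cell (p x))) ⟩
    sum (λ y → cell i (p y)) + sum (λ x → cell (p x) i + sum (λ y → cell (p x) (p y)))
  ≡⟨ cong (sum (λ y → cell i (p y)) +_) (∑-distrib-+ (λ x → cell (p x) i) _) ⟩
    sum (λ y → cell i (p y)) + (sum (λ x → cell (p x) i) + sum (λ x → sum (λ y → cell (p x) (p y))))
  ≡⟨ +-assoc (sum (λ y → cell i (p y))) _ _ ⟨
    (sum (λ y → cell i (p y)) + sum (λ x → cell (p x) i)) + sum (λ x → sum (λ y → cell (p x) (p y)))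
  ≡⟨ cong₂ _+_ (trans (sym (∑-distrib-+ (λ y → cell i (p y)) (λ y → cell (p y) i))) (sum-cong-≗ at-i))
               (sum-cong-≗ λ x → sum-cong-≗ λ y → cong (λ b → ⟦ b ∧ F (p x) (p y) ⟧) (<ᶠ-punchIn i x y)) ⟩
    ∣ F i ∘ p ∣ᵥ + ∣ restrict i F ∣ₑ
  ≡⟨ +-comm ∣ F i ∘ p ∣ᵥ _ ⟩
    ∣ restrict i F ∣ₑ + ∣ F i ∘ p ∣ᵥ ∎
  where
  open ≡-Reasoning
  p : Fin m → Fin (suc m)
  p = punchIn i
  cell : Fin (suc m) → Fin (suc m) → ℕ
  cell x y = ⟦ x <ᶠ y ∧ F x y ⟧
  row-i : sum (cell i) ≡ sum (λ y → cell i (p y))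
  row-i = trans (sum-remove {i = i} (cell i)) (cong (λ b → ⟦ b ∧ F i i ⟧ + sum (λ y → cell i (p y))) (<ᶠ-irrefl i))
  at-i : ∀ y → cell i (p y) + cell (p y) i ≡ ⟦ F i (p y) ⟧
  at-i y = trans (cong (λ b → cell i (p y) + ⟦ p y <ᶠ i ∧ b ⟧) (F-sym (p y) i))
                 (<ᶠ-either i (p y) (F i (p y)) (Fin.punchInᵢ≢i i y ∘ sym))

single-sym : ∀ {n} (a b : Fin n) → SymRel (single a b)
single-sym a b x y = trans (∨-comm (x == a ∧ y == b) _) (cong₂ _∨_ (∧-comm (x == b) _) (∧-comm (x == a) _))

single-self : ∀ {n} (a b : Fin n) → single a b a b ≡ true
single-self a b rewrite ==-refl a | ==-refl b = refl

single-sound : ∀ {n} {a b x y : Fin n} → single a b x y ≡ true → (x ≡ a × y ≡ b) ⊎ (x ≡ b × y ≡ a)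
single-sound xy∈ab with ∨-true xy∈ab
... | inj₁ xy≡ab = let (x≡a , y≡b) = ∧-true xy≡ab in inj₁ (==-sound x≡a , ==-sound y≡b)
... | inj₂ xy≡ba = let (x≡b , y≡a) = ∧-true xy≡ba in inj₂ (==-sound x≡b , ==-sound y≡a)

single-irrefl : ∀ {n} {a b : Fin n} → a ≢ b → ∀ i → single a b i i ≡ false
single-irrefl {a = a} {b} a≢b i = false-unless-true λ ii∈ab → impossible (single-sound {a = a} {b} {i} {i} ii∈ab)
  where
  impossible : (i ≡ a × i ≡ b) ⊎ (i ≡ b × i ≡ a) → ⊥
  impossible (inj₁ (refl , refl)) = a≢b refl
  impossible (inj₂ (refl , refl)) = a≢b refl

edges-single : ∀ {n} (a b : Fin n) → a ≢ b → ∣ single a b ∣ₑ ≡ 1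
edges-single {suc m} a b a≢b = begin
    ∣ single a b ∣ₑ
  ≡⟨ edges-split a (single a b) (single-sym a b) ⟩
    ∣ restrict a (single a b) ∣ₑ + ∣ single a b a ∘ p ∣ᵥ
  ≡⟨ cong₂ _+_ (edges-empty away-from-a) (size-cong at-a) ⟩
    0 + ∣ (_== b) ∘ p ∣ᵥ
  ≡⟨ cong (λ c → ⟦ c ⟧ + ∣ (_== b) ∘ p ∣ᵥ) (==-≢ a≢b) ⟨
    ⟦ a == b ⟧ + ∣ (_== b) ∘ p ∣ᵥ
  ≡⟨ trans (sym (size-split a (_== b))) (size-singleton b) ⟩
    1 ∎
  where
  open ≡-Reasoning
  p : Fin m → Fin (suc m)
  p = punchIn a
  away-from-a : ∀ x y → restrict a (single a b) x y ≡ false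
  away-from-a x y rewrite ==-≢ (Fin.punchInᵢ≢i a x) | ==-≢ (Fin.punchInᵢ≢i a y) = ∧-zeroʳ (p x == b)
  at-a : ∀ y → single a b a (p y) ≡ (p y == b)
  at-a y rewrite ==-refl a | ==-≢ a≢b = ∨-identityʳ (p y == b)

edges-add-edge : ∀ {n} (F : Rel n) {c d : Fin n} → c ≢ d → F c d ≡ false → F d c ≡ false →
                 ∣ F ∨ᵣ single c d ∣ₑ ≡ suc ∣ F ∣ₑ
edges-add-edge F {c} {d} c≢d Fcd Fdc = begin
    ∣ F ∨ᵣ single c d ∣ₑ
  ≡⟨ +-identityʳ _ ⟨
    ∣ F ∨ᵣ single c d ∣ₑ + 0
  ≡⟨ cong (∣ F ∨ᵣ single c d ∣ₑ +_) (edges-empty disjoint) ⟨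
    ∣ F ∨ᵣ single c d ∣ₑ + ∣ F ∧ᵣ single c d ∣ₑ
  ≡⟨ edges-inclusion-exclusion F (single c d) ⟨
    ∣ F ∣ₑ + ∣ single c d ∣ₑ
  ≡⟨ trans (cong (∣ F ∣ₑ +_) (edges-single c d c≢d)) (+-comm ∣ F ∣ₑ 1) ⟩
    suc ∣ F ∣ₑ ∎
  where
  open ≡-Reasoning
  disjoint : ∀ x y → (F x y ∧ single c d x y) ≡ false
  disjoint x y with single c d x y in xy∈cd
  ... | false = ∧-zeroʳ (F x y)
  ... | true with single-sound {a = c} {d} {x} {y} xy∈cd
  ...   | inj₁ (refl , refl) = cong (_∧ true) Fcd
  ...   | inj₂ (refl , refl) = cong (_∧ true) Fdc

edges-∨ᵣ : ∀ {n} (F H : Rel n) → ∣ F ∨ᵣ H ∣ₑ ≤ ∣ F ∣ₑ + ∣ H ∣ₑ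
edges-∨ᵣ F H = subst (∣ F ∨ᵣ H ∣ₑ ≤_) (sym (edges-inclusion-exclusion F H)) (m≤m+n _ _)

induced : ∀ {n} → Graph n → VSet n → Rel n
induced G S x y = S x ∧ S y ∧ adj G x y

induced-sym : ∀ {n} (G : Graph n) (S : VSet n) → SymRel (induced G S)
induced-sym G S x y rewrite Graph.sym G x y with S x | S y
... | true | true = refl
... | true | false = refl
... | false | true = refl
... | false | false = refl

induced-intro : ∀ {n} (G : Graph n) (S : VSet n) {x y} →
                S x ≡ true → S y ≡ true → Edge G x y → induced G S x y ≡ true
induced-intro G S Sx Sy xy∈G rewrite Sx | Sy = xy∈G

induced-elim : ∀ {n} (G : Graph n) (S : VSet n) {x y} →
               induced G S x y ≡ true → S x ≡ true × S y ≡ true × Edge G x y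
induced-elim G S xy∈S = let (Sx , rest) = ∧-true xy∈S ; (Sy , xy∈G) = ∧-true rest in Sx , Sy , xy∈G

induced-outside : ∀ {n} (G : Graph n) (S : VSet n) {x y} →
                  S x ≡ false ⊎ S y ≡ false → induced G S x y ≡ false
induced-outside G S (inj₁ Sx≡false) rewrite Sx≡false = refl
induced-outside G S {x} (inj₂ Sy≡false) rewrite Sy≡false = ∧-zeroʳ (S x)

inducedSubgraph : ∀ {n} (G : Graph n) → VSet n → Subgraph G
inducedSubgraph G S = record
  { VH = S ; EH = induced G S ; EH-sym = induced-sym G S
  ; EH⊆E = λ x y → proj₂ ∘ proj₂ ∘ induced-elim G S
  ; EH-endˡ = λ x y → proj₁ ∘ induced-elim G S
  ; EH-endʳ = λ x y → proj₁ ∘ proj₂ ∘ induced-elim G S }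

induced-sparse : ∀ {n} {G : Graph n} → Laman G → (S : VSet n) → 2 ≤ ∣ S ∣ᵥ →
                 ∣ induced G S ∣ₑ + 3 ≤ 2 * ∣ S ∣ᵥ
induced-sparse {G = G} laman S two≤S =
  subst₂ (λ e v → e + 3 ≤ 2 * v) (countE≡∣∣ₑ (induced G S)) (countV≡∣∣ᵥ S)
    (Laman.sparse laman (inducedSubgraph G S) (subst (2 ≤_) (sym (countV≡∣∣ᵥ S)) two≤S))

-- Conversely, the edge count and sparsity of induced subgraphs make a graph Laman,
-- since every subgraph has at most the edges of the subgraph induced on its vertices.
laman-from-induced : ∀ {n} (G : Graph n) → ∣ adj G ∣ₑ + 3 ≡ 2 * n →
  (∀ S → 2 ≤ ∣ S ∣ᵥ → ∣ induced G S ∣ₑ + 3 ≤ 2 * ∣ S ∣ᵥ) → Laman G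
laman-from-induced G count sparse = record
  { count = trans (cong (_+ 3) (countE≡∣∣ₑ (adj G))) count
  ; sparse = λ H two≤H →
      subst₂ (λ e v → e + 3 ≤ 2 * v) (sym (countE≡∣∣ₑ (EH H))) (sym (countV≡∣∣ᵥ (VH H)))
        (≤-trans (+-monoˡ-≤ 3 (edges-mono (H⊆induced H)))
                 (sparse (VH H) (subst (2 ≤_) (countV≡∣∣ᵥ (VH H)) two≤H))) }
  where
  H⊆induced : ∀ H x y → EH H x y ≡ true → induced G (VH H) x y ≡ true
  H⊆induced H x y xy∈H = induced-intro G (VH H) (EH-endˡ H x y xy∈H) (EH-endʳ H x y xy∈H) (EH⊆E H x y xy∈H)

edge-sym : ∀ {n} (G : Graph n) {x y} → Edge G x y → Edge G y x
edge-sym G {x} {y} xy∈G = trans (Graph.sym G y x) xy∈G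

edge-≢ : ∀ {n} (G : Graph n) {x y} → Edge G x y → x ≢ y
edge-≢ G {x} xy∈G refl = false≢true (trans (sym (Graph.irrefl G x)) xy∈G)

edges-avoiding : ∀ {m} (G : Graph (suc m)) (i : Fin (suc m)) (S : VSet (suc m)) → S i ≡ false →
                 ∣ induced G S ∣ₑ ≡ ∣ restrict i (induced G S) ∣ₑ
edges-avoiding {m} G i S Si≡false = begin
    ∣ induced G S ∣ₑ
  ≡⟨ edges-split i _ (induced-sym G S) ⟩
    ∣ restrict i (induced G S) ∣ₑ + ∣ induced G S i ∘ punchIn i ∣ᵥ
  ≡⟨ cong (∣ restrict i (induced G S) ∣ₑ +_) (size-avoiding i (induced G S i) no-edge-at-i) ⟨
    ∣ restrict i (induced G S) ∣ₑ + ∣ induced G S i ∣ᵥ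
  ≡⟨ cong (∣ restrict i (induced G S) ∣ₑ +_) (size-cong no-edges-at-i) ⟩
    ∣ restrict i (induced G S) ∣ₑ + ∣ (λ (_ : Fin (suc m)) → false) ∣ᵥ
  ≡⟨ trans (cong (∣ restrict i (induced G S) ∣ₑ +_) (size-empty (suc m))) (+-identityʳ _) ⟩
    ∣ restrict i (induced G S) ∣ₑ ∎
  where
  open ≡-Reasoning
  no-edges-at-i : ∀ y → induced G S i y ≡ false
  no-edges-at-i y rewrite Si≡false = refl
  no-edge-at-i : induced G S i i ≡ false
  no-edge-at-i = no-edges-at-i i

edges-insert : ∀ {m} (G : Graph (suc m)) (i : Fin (suc m)) (S : VSet (suc m)) → S i ≡ false →
               ∣ induced G (insert i S) ∣ₑ ≡ ∣ induced G S ∣ₑ + ∣ S ∩ adj G i ∣ᵥ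
edges-insert {m} G i S Si≡false = begin
    ∣ induced G (insert i S) ∣ₑ
  ≡⟨ edges-split i _ (induced-sym G (insert i S)) ⟩
    ∣ restrict i (induced G (insert i S)) ∣ₑ + ∣ induced G (insert i S) i ∘ p ∣ᵥ
  ≡⟨ cong₂ _+_ (edges-cong away-from-i) (size-cong at-i) ⟩
    ∣ restrict i (induced G S) ∣ₑ + ∣ (S ∩ adj G i) ∘ p ∣ᵥ
  ≡⟨ cong₂ _+_ (edges-avoiding G i S Si≡false)
               (size-avoiding i (S ∩ adj G i) (cong (_∧ adj G i i) Si≡false)) ⟨
    ∣ induced G S ∣ₑ + ∣ S ∩ adj G i ∣ᵥ ∎
  where
  open ≡-Reasoning
  p : Fin m → Fin (suc m)
  p = punchIn i
  away-from-i : ∀ x y → restrict i (induced G (insert i S)) x y ≡ restrict i (induced G S) x y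
  away-from-i x y rewrite insert-other S (Fin.punchInᵢ≢i i x) | insert-other S (Fin.punchInᵢ≢i i y) = refl
  at-i : ∀ y → induced G (insert i S) i (p y) ≡ (S ∩ adj G i) (p y)
  at-i y rewrite insert-self i S | insert-other S (Fin.punchInᵢ≢i i y) = refl

edges-small : ∀ {n} (G : Graph n) (S : VSet n) → ¬ (2 ≤ ∣ S ∣ᵥ) → ∣ induced G S ∣ₑ ≡ 0
edges-small G S S<2 = edges-empty no-edge
  where
  no-edge : ∀ x y → induced G S x y ≡ false
  no-edge x y with induced G S x y in xy∈S
  ... | false = refl
  ... | true = let (Sx , Sy , xy∈G) = induced-elim G S xy∈S in
    contradiction (members-≤-size S (x ∷ y ∷ []) ((edge-≢ G xy∈G ∷ []) ∷ [] ∷ []) (Sx ∷ Sy ∷ [])) S<2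

degree-3-neighbours : ∀ {n} (G : Graph n) {x a b c} → deg G x ≡ 3 →
  Edge G x a → Edge G x b → Edge G x c → a ≢ b → a ≢ c → b ≢ c →
  ∀ z → Edge G x z → z ≡ a ⊎ z ≡ b ⊎ z ≡ c
degree-3-neighbours G {x} {a} {b} {c} deg≡3 xa xb xc a≢b a≢c b≢c z xz
  with z Fin.≟ a | z Fin.≟ b | z Fin.≟ c
... | yes z≡a | _ | _ = inj₁ z≡a
... | no _ | yes z≡b | _ = inj₂ (inj₁ z≡b)
... | no _ | no _ | yes z≡c = inj₂ (inj₂ z≡c)
... | no z≢a | no z≢b | no z≢c = contradiction four≤deg λ where (s≤s (s≤s (s≤s ())))
  where
  distinct : Unique (a ∷ b ∷ c ∷ z ∷ [])
  distinct = (a≢b ∷ a≢c ∷ (z≢a ∘ sym) ∷ []) ∷ (b≢c ∷ (z≢b ∘ sym) ∷ []) ∷ ((z≢c ∘ sym) ∷ []) ∷ [] ∷ []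
  four≤deg : 4 ≤ 3
  four≤deg = subst (4 ≤_) (trans (sym (countV≡∣∣ᵥ (adj G x))) deg≡3)
    (members-≤-size (adj G x) _ distinct (xa ∷ xb ∷ xc ∷ xz ∷ []))

not-neighbour : ∀ {n} (G : Graph n) {x a b c z} → deg G x ≡ 3 →
  Edge G x a → Edge G x b → Edge G x c → a ≢ b → a ≢ c → b ≢ c →
  z ≢ a → z ≢ b → z ≢ c → ¬ Edge G x z
not-neighbour G deg≡3 xa xb xc a≢b a≢c b≢c z≢a z≢b z≢c xz
  with degree-3-neighbours G deg≡3 xa xb xc a≢b a≢c b≢c _ xz
... | inj₁ z≡a = z≢a z≡a
... | inj₂ (inj₁ z≡b) = z≢b z≡b
... | inj₂ (inj₂ z≡c) = z≢c z≡c

nonempty : ∀ {n} (S : VSet n) {a} → S a ≡ true → 1 ≤ ∣ S ∣ᵥ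
nonempty S Sa = members-≤-size S (_ ∷ []) ([] ∷ []) (Sa ∷ [])

two-neighbours : ∀ {n} (G : Graph n) (S : VSet n) {i a b} → a ≢ b →
  S a ≡ true → S b ≡ true → Edge G i a → Edge G i b → 2 ≤ ∣ S ∩ adj G i ∣ᵥ
two-neighbours G S a≢b Sa Sb ia ib =
  members-≤-size (S ∩ adj G _) (_ ∷ _ ∷ []) ((a≢b ∷ []) ∷ [] ∷ []) (∧-intro Sa ia ∷ ∧-intro Sb ib ∷ [])

three-neighbours : ∀ {n} (G : Graph n) (S : VSet n) {i a b c} → a ≢ b → a ≢ c → b ≢ c →
  S a ≡ true → S b ≡ true → S c ≡ true → Edge G i a → Edge G i b → Edge G i c → 3 ≤ ∣ S ∩ adj G i ∣ᵥ
three-neighbours G S a≢b a≢c b≢c Sa Sb Sc ia ib ic =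
  members-≤-size (S ∩ adj G _) (_ ∷ _ ∷ _ ∷ []) ((a≢b ∷ a≢c ∷ []) ∷ (b≢c ∷ []) ∷ [] ∷ [])
    (∧-intro Sa ia ∷ ∧-intro Sb ib ∷ ∧-intro Sc ic ∷ [])

-- S is tight if it spans at least 2|S| - 3 edges; in a Laman graph this is the most
-- sparsity allows, so tight sets span exactly 2|S| - 3 edges.
Tight : ∀ {n} → Graph n → VSet n → Set
Tight G S = 2 * ∣ S ∣ᵥ ≤ ∣ induced G S ∣ₑ + 3

tight-no-3-extension : ∀ {m} {G : Graph (suc m)} → Laman G → (S : VSet (suc m)) (i : Fin (suc m)) →
  Tight G S → S i ≡ false → 1 ≤ ∣ S ∣ᵥ → 3 ≤ ∣ S ∩ adj G i ∣ᵥ → ⊥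
tight-no-3-extension {G = G} laman S i tight Si≡false one≤S three≤N =
  arithmetic ∣ induced G S ∣ₑ ∣ S ∣ᵥ ∣ S ∩ adj G i ∣ᵥ tight three≤N sparse-after
  where
  sparse-after : ∣ induced G S ∣ₑ + ∣ S ∩ adj G i ∣ᵥ + 3 ≤ 2 * suc ∣ S ∣ᵥ
  sparse-after = subst₂ (λ e v → e + 3 ≤ 2 * v) (edges-insert G i S Si≡false) (size-insert i S Si≡false)
    (induced-sparse laman (insert i S) (subst (2 ≤_) (sym (size-insert i S Si≡false)) (s≤s one≤S)))
  arithmetic : ∀ e s k → 2 * s ≤ e + 3 → 3 ≤ k → e + k + 3 ≤ 2 * suc s → ⊥
  arithmetic e s k tight three≤k sparse = <-irrefl refl (begin-strict
      e + 5            <⟨ n<1+n (e + 5) ⟩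
      suc (e + 5)      ≡⟨ trans (sym (+-suc e 5)) (sym (+-assoc e 3 3)) ⟩
      e + 3 + 3        ≤⟨ +-monoˡ-≤ 3 (+-monoʳ-≤ e three≤k) ⟩
      e + k + 3        ≤⟨ sparse ⟩
      2 * suc s        ≡⟨ *-distribˡ-+ 2 1 s ⟩
      2 + 2 * s        ≤⟨ +-monoʳ-≤ 2 tight ⟩
      2 + (e + 3)      ≡⟨ trans (+-comm 2 (e + 3)) (+-assoc e 3 2) ⟩
      e + 5            ∎)
    where open ≤-Reasoning

tight-2-extension : ∀ {m} (G : Graph (suc m)) (S : VSet (suc m)) (i : Fin (suc m)) →
  Tight G S → S i ≡ false → 2 ≤ ∣ S ∩ adj G i ∣ᵥ → Tight G (insert i S)
tight-2-extension G S i tight Si≡false two≤N =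
  subst₂ (λ s e → 2 * s ≤ e + 3) (sym (size-insert i S Si≡false)) (sym (edges-insert G i S Si≡false))
    (arithmetic ∣ induced G S ∣ₑ ∣ S ∣ᵥ ∣ S ∩ adj G i ∣ᵥ tight two≤N)
  where
  arithmetic : ∀ e s k → 2 * s ≤ e + 3 → 2 ≤ k → 2 * suc s ≤ e + k + 3
  arithmetic e s k tight two≤k = begin
      2 * suc s        ≡⟨ *-distribˡ-+ 2 1 s ⟩
      2 + 2 * s        ≤⟨ +-mono-≤ two≤k tight ⟩
      k + (e + 3)      ≡⟨ rearrange e k ⟩
      e + k + 3        ∎
    where
    open ≤-Reasoning
    rearrange : ∀ e k → k + (e + 3) ≡ e + k + 3
    rearrange = solve-∀

induced-∩ : ∀ {n} (G : Graph n) (A B : VSet n) x y →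
            (induced G A ∧ᵣ induced G B) x y ≡ induced G (A ∩ B) x y
induced-∩ G A B x y = regroup (A x) (B x) (A y) (B y) (adj G x y)
  where
  regroup : ∀ a b c d e → (a ∧ c ∧ e) ∧ (b ∧ d ∧ e) ≡ (a ∧ b) ∧ (c ∧ d) ∧ e
  regroup false b c d e = refl
  regroup true false c d e = ∧-zeroʳ (c ∧ e)
  regroup true true false d e = refl
  regroup true true true false e = ∧-zeroʳ e
  regroup true true true true e = ∧-idem e

induced-∪ : ∀ {n} (G : Graph n) (A B : VSet n) x y →
            (induced G A ∨ᵣ induced G B) x y ≡ true → induced G (A ∪ B) x y ≡ true
induced-∪ G A B x y xy∈A∨B with ∨-true xy∈A∨B
... | inj₁ xy∈A = let (Ax , Ay , xy∈G) = induced-elim G A xy∈A in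
  induced-intro G (A ∪ B) (∨-introˡ (B x) Ax) (∨-introˡ (B y) Ay) xy∈G
... | inj₂ xy∈B = let (Bx , By , xy∈G) = induced-elim G B xy∈B in
  induced-intro G (A ∪ B) (∨-introʳ (A x) Bx) (∨-introʳ (A y) By) xy∈G

edges-induced-inclusion-exclusion : ∀ {n} (G : Graph n) (A B : VSet n) →
  ∣ induced G A ∣ₑ + ∣ induced G B ∣ₑ ≡ ∣ induced G A ∨ᵣ induced G B ∣ₑ + ∣ induced G (A ∩ B) ∣ₑ
edges-induced-inclusion-exclusion G A B =
  trans (edges-inclusion-exclusion (induced G A) (induced G B))
        (cong (∣ induced G A ∨ᵣ induced G B ∣ₑ +_) (edges-cong (induced-∩ G A B)))

tight-union : ∀ {n} {G : Graph n} → Laman G → (A B : VSet n) →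
  Tight G A → Tight G B → 2 ≤ ∣ A ∩ B ∣ᵥ → Tight G (A ∪ B)
tight-union {G = G} laman A B tight-A tight-B two≤A∩B =
  arithmetic ∣ A ∣ᵥ ∣ B ∣ᵥ ∣ A ∪ B ∣ᵥ ∣ A ∩ B ∣ᵥ
             ∣ induced G A ∣ₑ ∣ induced G B ∣ₑ ∣ induced G (A ∪ B) ∣ₑ ∣ induced G (A ∩ B) ∣ₑ
    (size-inclusion-exclusion A B) tight-A tight-B
    (subst (_≤ ∣ induced G (A ∪ B) ∣ₑ + ∣ induced G (A ∩ B) ∣ₑ) (sym (edges-induced-inclusion-exclusion G A B))
      (+-monoˡ-≤ _ (edges-mono (induced-∪ G A B))))
    (induced-sparse laman (A ∩ B) two≤A∩B)
  where
  arithmetic : ∀ a b c d ea eb ec ed → a + b ≡ c + d → 2 * a ≤ ea + 3 → 2 * b ≤ eb + 3 →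
               ea + eb ≤ ec + ed → ed + 3 ≤ 2 * d → 2 * c ≤ ec + 3
  arithmetic a b c d ea eb ec ed sizes tight-a tight-b edges sparse-d =
    +-cancelʳ-≤ (2 * d) (2 * c) (ec + 3) (begin
      2 * c + 2 * d          ≡⟨ *-distribˡ-+ 2 c d ⟨
      2 * (c + d)            ≡⟨ cong (2 *_) sizes ⟨
      2 * (a + b)            ≡⟨ *-distribˡ-+ 2 a b ⟩
      2 * a + 2 * b          ≤⟨ +-mono-≤ tight-a tight-b ⟩
      (ea + 3) + (eb + 3)    ≡⟨ regroup ea eb ⟩
      (ea + eb) + 6          ≤⟨ +-monoˡ-≤ 6 edges ⟩
      (ec + ed) + 6          ≡⟨ regroup ec ed ⟨
      (ec + 3) + (ed + 3)    ≤⟨ +-monoʳ-≤ (ec + 3) sparse-d ⟩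
      (ec + 3) + 2 * d       ∎)
    where
    open ≤-Reasoning
    regroup : ∀ x y → (x + 3) + (y + 3) ≡ (x + y) + 6
    regroup = solve-∀

tight-union-bridged : ∀ {n} (G : Graph n) (A B : VSet n) {c d} →
  Tight G A → Tight G B → ¬ (2 ≤ ∣ A ∩ B ∣ᵥ) → 1 ≤ ∣ A ∩ B ∣ᵥ →
  Edge G c d → A c ≡ false → B c ≡ true → A d ≡ true → B d ≡ false → Tight G (A ∪ B)
tight-union-bridged {n} G A B {c} {d} tight-A tight-B A∩B<2 one≤A∩B cd∈G Ac Bc Ad Bd =
  arithmetic ∣ A ∣ᵥ ∣ B ∣ᵥ ∣ A ∪ B ∣ᵥ ∣ A ∩ B ∣ᵥ ∣ induced G A ∣ₑ ∣ induced G B ∣ₑ ∣ induced G (A ∪ B) ∣ₑ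
    (size-inclusion-exclusion A B) tight-A tight-B bridged-edges one≤A∩B
  where
  A∨B : Rel n
  A∨B = induced G A ∨ᵣ induced G B
  not-in-A∨B : ∀ {x y} → A x ≡ false ⊎ A y ≡ false → B x ≡ false ⊎ B y ≡ false → A∨B x y ≡ false
  not-in-A∨B A-out B-out = cong₂ _∨_ (induced-outside G A A-out) (induced-outside G B B-out)
  bridged-edges : suc (∣ induced G A ∣ₑ + ∣ induced G B ∣ₑ) ≤ ∣ induced G (A ∪ B) ∣ₑ
  bridged-edges = begin
      suc (∣ induced G A ∣ₑ + ∣ induced G B ∣ₑ)
    ≡⟨ cong suc (trans (edges-induced-inclusion-exclusion G A B)
                       (trans (cong (∣ A∨B ∣ₑ +_) (edges-small G (A ∩ B) A∩B<2)) (+-identityʳ _))) ⟩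
      suc ∣ A∨B ∣ₑ
    ≡⟨ edges-add-edge A∨B (edge-≢ G cd∈G) (not-in-A∨B (inj₁ Ac) (inj₂ Bd)) (not-in-A∨B (inj₂ Ac) (inj₁ Bd)) ⟨
      ∣ A∨B ∨ᵣ single c d ∣ₑ
    ≤⟨ edges-mono in-A∪B ⟩
      ∣ induced G (A ∪ B) ∣ₑ ∎
    where
    open ≤-Reasoning
    in-A∪B : ∀ x y → (A∨B ∨ᵣ single c d) x y ≡ true → induced G (A ∪ B) x y ≡ true
    in-A∪B x y xy∈ with ∨-true xy∈
    ... | inj₁ xy∈A∨B = induced-∪ G A B x y xy∈A∨B
    ... | inj₂ xy∈cd with single-sound {a = c} {d} {x} {y} xy∈cd
    ...   | inj₁ (refl , refl) = induced-intro G (A ∪ B) (∨-introʳ (A c) Bc) (∨-introˡ (B d) Ad) cd∈G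
    ...   | inj₂ (refl , refl) = induced-intro G (A ∪ B) (∨-introˡ (B d) Ad) (∨-introʳ (A c) Bc) (edge-sym G cd∈G)
  arithmetic : ∀ a b c d ea eb ec → a + b ≡ c + d → 2 * a ≤ ea + 3 → 2 * b ≤ eb + 3 →
               suc (ea + eb) ≤ ec → 1 ≤ d → 2 * c ≤ ec + 3
  arithmetic a b c d ea eb ec sizes tight-a tight-b edges one≤d =
    +-cancelʳ-≤ 2 (2 * c) (ec + 3) (begin
      2 * c + 2              ≤⟨ +-monoʳ-≤ (2 * c) (*-monoʳ-≤ 2 one≤d) ⟩
      2 * c + 2 * d          ≡⟨ *-distribˡ-+ 2 c d ⟨
      2 * (c + d)            ≡⟨ cong (2 *_) sizes ⟨
      2 * (a + b)            ≡⟨ *-distribˡ-+ 2 a b ⟩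
      2 * a + 2 * b          ≤⟨ +-mono-≤ tight-a tight-b ⟩
      (ea + 3) + (eb + 3)    ≡⟨ regroup ea eb ⟩
      suc (ea + eb) + 5      ≤⟨ +-monoˡ-≤ 5 edges ⟩
      ec + 5                 ≡⟨ +-assoc ec 3 2 ⟨
      (ec + 3) + 2           ∎)
    where
    open ≤-Reasoning
    regroup : ∀ x y → (x + 3) + (y + 3) ≡ suc (x + y) + 5
    regroup = solve-∀

-- A tight set containing a and b but not x.  Its existence is exactly what can
-- prevent replacing a degree-3 vertex x by the edge ab.
Blocking : ∀ {n} → Graph n → (x a b : Fin n) → VSet n → Set
Blocking G x a b S = S x ≡ false × S a ≡ true × S b ≡ true × Tight G S

-- In the configuration of the theorem (triangle u v u₁, third neighbours w of u and
-- u₂ of v, edge w u₂), the reductions at v and at u cannot both be blocked: the union of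
-- the two blocking sets, enlarged by u, would be tight and contain three neighbours of v.
blockers-incompatible : ∀ {m} {G : Graph (suc m)} → Laman G → {u v u₁ w u₂ : Fin (suc m)} →
  Edge G u v → Edge G v u₁ → Edge G u u₁ → Edge G u w → Edge G v u₂ → Edge G w u₂ →
  v ≢ w → u₁ ≢ w → u ≢ u₂ → u₁ ≢ u₂ →
  (A B : VSet (suc m)) → Blocking G v u₁ u₂ A → Blocking G u u₁ w B → ⊥
blockers-incompatible {m} {G} laman {u} {v} {u₁} {w} {u₂} uv vu₁ uu₁ uw vu₂ wu₂ v≢w u₁≢w u≢u₂ u₁≢u₂
  A B (Av , Au₁ , Au₂ , tight-A) (Bu , Bu₁ , Bw , tight-B) =
  tight-no-3-extension laman C⁺ v tight-C⁺ C⁺v (nonempty C⁺ C⁺u)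
    (three-neighbours G C⁺ u≢u₁ u≢u₂ u₁≢u₂ C⁺u (in-C⁺ (∨-introˡ (B u₁) Au₁)) (in-C⁺ (∨-introˡ (B u₂) Au₂))
                      (edge-sym G uv) vu₁ vu₂)
  where
  u≢u₁ : u ≢ u₁
  u≢u₁ = edge-≢ G uu₁
  v≢u₁ : v ≢ u₁
  v≢u₁ = edge-≢ G vu₁
  C C⁺ : VSet (suc m)
  C = A ∪ B
  C⁺ = insert u C
  in-C⁺ : ∀ {x} → C x ≡ true → C⁺ x ≡ true
  in-C⁺ {x} = ∨-introˡ (x == u)
  Au : A u ≡ false
  Au = false-unless-true λ Au → tight-no-3-extension laman A v tight-A Av (nonempty A Au₁)
    (three-neighbours G A u≢u₁ u≢u₂ u₁≢u₂ Au Au₁ Au₂ (edge-sym G uv) vu₁ vu₂)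
  Bv : B v ≡ false
  Bv = false-unless-true λ Bv → tight-no-3-extension laman B u tight-B Bu (nonempty B Bu₁)
    (three-neighbours G B v≢u₁ v≢w u₁≢w Bv Bu₁ Bw uv uu₁ uw)
  A∩B-u₁ : (A ∩ B) u₁ ≡ true
  A∩B-u₁ = ∧-intro Au₁ Bu₁
  tight-C : Tight G C
  tight-C with 2 ≤? ∣ A ∩ B ∣ᵥ
  ... | yes two≤A∩B = tight-union laman A B tight-A tight-B two≤A∩B
  ... | no A∩B<2 = tight-union-bridged G A B tight-A tight-B A∩B<2 (nonempty (A ∩ B) A∩B-u₁) wu₂ Aw Bw Au₂ Bu₂
    where
    only-u₁ : ∀ {x} → u₁ ≢ x → (A ∩ B) x ≡ true → ⊥
    only-u₁ u₁≢x A∩B-x = A∩B<2 (members-≤-size (A ∩ B) (_ ∷ _ ∷ []) ((u₁≢x ∷ []) ∷ [] ∷ []) (A∩B-u₁ ∷ A∩B-x ∷ []))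
    Aw : A w ≡ false
    Aw = false-unless-true λ Aw → only-u₁ u₁≢w (∧-intro Aw Bw)
    Bu₂ : B u₂ ≡ false
    Bu₂ = false-unless-true λ Bu₂ → only-u₁ u₁≢u₂ (∧-intro Au₂ Bu₂)
  Cu : C u ≡ false
  Cu rewrite Au | Bu = refl
  C⁺u : C⁺ u ≡ true
  C⁺u = insert-self u C
  C⁺v : C⁺ v ≡ false
  C⁺v rewrite Av | Bv = ==-≢ (edge-≢ G uv ∘ sym)
  tight-C⁺ : Tight G C⁺
  tight-C⁺ = tight-2-extension G C u tight-C Cu
    (two-neighbours G C u₁≢w (∨-introˡ (B u₁) Au₁) (∨-introʳ (A w) Bw) uu₁ uw)

blocking-resp : ∀ {n} (G : Graph n) {x a b} {S T : VSet n} → (∀ y → S y ≡ T y) →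
                Blocking G x a b S → Blocking G x a b T
blocking-resp G {x} {a} {b} {S} {T} S≗T (Sx , Sa , Sb , tight) =
  trans (sym (S≗T x)) Sx , trans (sym (S≗T a)) Sa , trans (sym (S≗T b)) Sb ,
  subst₂ (λ s e → 2 * s ≤ e + 3) (size-cong S≗T)
    (edges-cong λ y z → cong₂ (λ p q → p ∧ q ∧ adj G y z) (S≗T y) (S≗T z)) tight

blocking? : ∀ {n} (G : Graph n) (x a b : Fin n) (S : VSet n) → Dec (Blocking G x a b S)
blocking? G x a b S = (S x ≟ᵇ false) ×-dec (S a ≟ᵇ true) ×-dec (S b ≟ᵇ true)
                      ×-dec (2 * ∣ S ∣ᵥ ≤? ∣ induced G S ∣ₑ + 3)

some-blocking? : ∀ {n} (G : Graph n) (x a b : Fin n) → Dec (Σ (VSet n) (Blocking G x a b))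
some-blocking? G x a b with anySubset? (blocking? G x a b ∘ Vec.lookup)
... | yes (s , s-blocks) = yes (Vec.lookup s , s-blocks)
... | no none = no λ (S , S-blocks) →
  none (Vec.tabulate S , blocking-resp G (sym ∘ lookup∘tabulate S) S-blocks)

deleteVertex : ∀ {m} → Graph (suc m) → Fin (suc m) → Graph m
deleteVertex G x = record
  { adj = restrict x (adj G)
  ; sym = λ i j → Graph.sym G (punchIn x i) (punchIn x j)
  ; irrefl = λ i → Graph.irrefl G (punchIn x i) }

addEdge : ∀ {m} (H : Graph m) (a b : Fin m) → a ≢ b → Graph m
addEdge H a b a≢b = record
  { adj = adj H ∨ᵣ single a b
  ; sym = λ i j → cong₂ _∨_ (Graph.sym H i j) (single-sym a b i j)
  ; irrefl = λ i → cong₂ _∨_ (Graph.irrefl H i) (single-irrefl a≢b i) }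

edges-delete-vertex : ∀ {m} (G : Graph (suc m)) (x : Fin (suc m)) →
                      ∣ adj G ∣ₑ ≡ ∣ adj (deleteVertex G x) ∣ₑ + deg G x
edges-delete-vertex G x = begin
    ∣ adj G ∣ₑ
  ≡⟨ edges-split x (adj G) (Graph.sym G) ⟩
    ∣ adj (deleteVertex G x) ∣ₑ + ∣ adj G x ∘ punchIn x ∣ᵥ
  ≡⟨ cong (∣ adj (deleteVertex G x) ∣ₑ +_) (size-avoiding x (adj G x) (Graph.irrefl G x)) ⟨
    ∣ adj (deleteVertex G x) ∣ₑ + ∣ adj G x ∣ᵥ
  ≡⟨ cong (∣ adj (deleteVertex G x) ∣ₑ +_) (countV≡∣∣ᵥ (adj G x)) ⟨
    ∣ adj (deleteVertex G x) ∣ₑ + deg G x ∎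
  where open ≡-Reasoning

lift : ∀ {m} → Fin (suc m) → VSet m → VSet (suc m)
lift x S = insertAt S x false

size-lift : ∀ {m} (x : Fin (suc m)) (S : VSet m) → ∣ lift x S ∣ᵥ ≡ ∣ S ∣ᵥ
size-lift x S = trans (size-avoiding x (lift x S) (insertAt-lookup S x false))
                      (size-cong (insertAt-punchIn S x false))

edges-lift : ∀ {m} (G : Graph (suc m)) (x : Fin (suc m)) (S : VSet m) →
             ∣ induced G (lift x S) ∣ₑ ≡ ∣ induced (deleteVertex G x) S ∣ₑ
edges-lift G x S = trans (edges-avoiding G x (lift x S) (insertAt-lookup S x false)) (edges-cong away-from-x)
  where
  away-from-x : ∀ i j → restrict x (induced G (lift x S)) i j ≡ induced (deleteVertex G x) S i j
  away-from-x i j rewrite insertAt-punchIn S x false i | insertAt-punchIn S x false j = refl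

reduced-laman : ∀ {m} {G : Graph (suc m)} → Laman G → (x : Fin (suc m)) {a b : Fin m} (a≢b : a ≢ b) →
  deg G x ≡ 3 → ¬ Edge G (punchIn x a) (punchIn x b) →
  (∀ S → ¬ Blocking G x (punchIn x a) (punchIn x b) S) →
  Laman (addEdge (deleteVertex G x) a b a≢b)
reduced-laman {m} {G} laman x {a} {b} a≢b deg≡3 ab∉G unblocked = laman-from-induced G' count sparse
  where
  H : Graph m
  H = deleteVertex G x
  G' : Graph m
  G' = addEdge H a b a≢b
  count : ∣ adj G' ∣ₑ + 3 ≡ 2 * m
  count = begin
      ∣ adj G' ∣ₑ + 3
    ≡⟨ cong (_+ 3) (edges-add-edge (adj H) a≢b (false-unless-true ab∉G)
                                   (false-unless-true (ab∉G ∘ edge-sym G))) ⟩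
      suc ∣ adj H ∣ₑ + 3
    ≡⟨ +-cancelˡ-≡ 2 _ _ (begin
         2 + (suc ∣ adj H ∣ₑ + 3)     ≡⟨ regroup ∣ adj H ∣ₑ ⟩
         ∣ adj H ∣ₑ + 3 + 3           ≡⟨ cong (λ d → ∣ adj H ∣ₑ + d + 3) deg≡3 ⟨
         ∣ adj H ∣ₑ + deg G x + 3     ≡⟨ cong (_+ 3) (edges-delete-vertex G x) ⟨
         ∣ adj G ∣ₑ + 3               ≡⟨ trans (cong (_+ 3) (sym (countE≡∣∣ₑ (adj G)))) (Laman.count laman) ⟩
         2 * suc m                    ≡⟨ *-distribˡ-+ 2 1 m ⟩
         2 + 2 * m                    ∎) ⟩
      2 * m ∎
    where
    open ≡-Reasoning
    regroup : ∀ r → 2 + (suc r + 3) ≡ r + 3 + 3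
    regroup = solve-∀
  -- If S contains a and b, then S lifted to G is not tight, which leaves room for ab.
  sparse-with-ab : ∀ S → S a ≡ true → S b ≡ true → ∣ induced G' S ∣ₑ + 3 ≤ 2 * ∣ S ∣ᵥ
  sparse-with-ab S Sa Sb = begin
      ∣ induced G' S ∣ₑ + 3
    ≤⟨ +-monoˡ-≤ 3 (≤-trans (edges-mono G'⊆H+ab) (edges-∨ᵣ (induced H S) (single a b))) ⟩
      ∣ induced H S ∣ₑ + ∣ single a b ∣ₑ + 3
    ≡⟨ cong (λ one → ∣ induced H S ∣ₑ + one + 3) (edges-single a b a≢b) ⟩
      ∣ induced H S ∣ₑ + 1 + 3
    ≡⟨ trans (+-assoc ∣ induced H S ∣ₑ 1 3) (+-suc ∣ induced H S ∣ₑ 3) ⟩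
      suc (∣ induced H S ∣ₑ + 3)
    ≤⟨ ≰⇒> not-tight ⟩
      2 * ∣ S ∣ᵥ ∎
    where
    open ≤-Reasoning
    G'⊆H+ab : ∀ i j → induced G' S i j ≡ true → (induced H S ∨ᵣ single a b) i j ≡ true
    G'⊆H+ab i j ij∈G' with induced-elim G' S ij∈G'
    ... | Si , Sj , ij∈H+ab with ∨-true ij∈H+ab
    ...   | inj₁ ij∈H = ∨-introˡ (single a b i j) (induced-intro H S Si Sj ij∈H)
    ...   | inj₂ ij∈ab = ∨-introʳ (induced H S i j) ij∈ab
    not-tight : ¬ (2 * ∣ S ∣ᵥ ≤ ∣ induced H S ∣ₑ + 3)
    not-tight tight = unblocked (lift x S)
      ( insertAt-lookup S x false
      , trans (insertAt-punchIn S x false a) Sa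
      , trans (insertAt-punchIn S x false b) Sb
      , subst₂ (λ s e → 2 * s ≤ e + 3) (sym (size-lift x S)) (sym (edges-lift G x S)) tight )
  -- Otherwise S spans no more edges in G' than in G ∖ x, where sparsity of G applies.
  sparse-without-ab : ∀ S → 2 ≤ ∣ S ∣ᵥ → S a ≡ false ⊎ S b ≡ false → ∣ induced G' S ∣ₑ + 3 ≤ 2 * ∣ S ∣ᵥ
  sparse-without-ab S two≤S ab∉S = begin
      ∣ induced G' S ∣ₑ + 3
    ≤⟨ +-monoˡ-≤ 3 (edges-mono G'⊆H) ⟩
      ∣ induced H S ∣ₑ + 3
    ≡⟨ cong (_+ 3) (edges-lift G x S) ⟨
      ∣ induced G (lift x S) ∣ₑ + 3
    ≤⟨ induced-sparse laman (lift x S) (subst (2 ≤_) (sym (size-lift x S)) two≤S) ⟩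
      2 * ∣ lift x S ∣ᵥ
    ≡⟨ cong (2 *_) (size-lift x S) ⟩
      2 * ∣ S ∣ᵥ ∎
    where
    open ≤-Reasoning
    ab⊈S : ¬ (S a ≡ true × S b ≡ true)
    ab⊈S (Sa , Sb) = [ (λ Sa≡false → false≢true (trans (sym Sa≡false) Sa))
                     , (λ Sb≡false → false≢true (trans (sym Sb≡false) Sb)) ]′ ab∉S
    G'⊆H : ∀ i j → induced G' S i j ≡ true → induced H S i j ≡ true
    G'⊆H i j ij∈G' with induced-elim G' S ij∈G'
    ... | Si , Sj , ij∈H+ab with ∨-true ij∈H+ab
    ...   | inj₁ ij∈H = induced-intro H S Si Sj ij∈H
    ...   | inj₂ ij∈ab with single-sound {a = a} {b} {i} {j} ij∈ab
    ...     | inj₁ (refl , refl) = contradiction (Si , Sj) ab⊈S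
    ...     | inj₂ (refl , refl) = contradiction (Sj , Si) ab⊈S
  sparse : ∀ S → 2 ≤ ∣ S ∣ᵥ → ∣ induced G' S ∣ₑ + 3 ≤ 2 * ∣ S ∣ᵥ
  sparse S two≤S with S a in Sa | S b in Sb
  ... | true | true = sparse-with-ab S Sa Sb
  ... | false | _ = sparse-without-ab S two≤S (inj₁ Sa)
  ... | true | false = sparse-without-ab S two≤S (inj₂ Sb)

reduced-move : ∀ {m} (G : Graph (suc m)) (x : Fin (suc m)) {y a b : Fin m} (a≢b : a ≢ b) →
  (∀ z → Edge G x z → z ≡ punchIn x y ⊎ z ≡ punchIn x a ⊎ z ≡ punchIn x b) →
  Edge G x (punchIn x y) → Edge G x (punchIn x a) → Edge G x (punchIn x b) →
  ¬ Edge G (punchIn x a) (punchIn x b) →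
  HennebergII (addEdge (deleteVertex G x) a b a≢b) G x y a b
reduced-move {m} G x {y} {a} {b} a≢b neighbours xy xa xb ab∉G = record
  { u₁u₂∈E' = ∨-introʳ (adj G (p a) (p b)) (single-self a b)
  ; old = λ i j → (λ ij∈G → ∨-introˡ (single a b i j) ij∈G , not-ab ij∈G) , kept i j
  ; new = λ i → old-neighbour i , new-edge i }
  where
  p : Fin m → Fin (suc m)
  p = punchIn x
  not-ab : ∀ {i j} → Edge G (p i) (p j) → ¬ ((i ≡ a × j ≡ b) ⊎ (i ≡ b × j ≡ a))
  not-ab ab∈G (inj₁ (refl , refl)) = ab∉G ab∈G
  not-ab ba∈G (inj₂ (refl , refl)) = ab∉G (edge-sym G ba∈G)
  kept : ∀ i j → Edge (addEdge (deleteVertex G x) a b a≢b) i j × ¬ ((i ≡ a × j ≡ b) ⊎ (i ≡ b × j ≡ a)) →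
         Edge G (p i) (p j)
  kept i j (ij∈G' , ij≢ab) with ∨-true ij∈G'
  ... | inj₁ ij∈G = ij∈G
  ... | inj₂ ij∈ab = contradiction (single-sound {a = a} {b} {i} {j} ij∈ab) ij≢ab
  old-neighbour : ∀ i → Edge G x (p i) → i ≡ y ⊎ i ≡ a ⊎ i ≡ b
  old-neighbour i xi with neighbours (p i) xi
  ... | inj₁ i≡y = inj₁ (Fin.punchIn-injective x i y i≡y)
  ... | inj₂ (inj₁ i≡a) = inj₂ (inj₁ (Fin.punchIn-injective x i a i≡a))
  ... | inj₂ (inj₂ i≡b) = inj₂ (inj₂ (Fin.punchIn-injective x i b i≡b))
  new-edge : ∀ i → i ≡ y ⊎ i ≡ a ⊎ i ≡ b → Edge G x (p i)
  new-edge i (inj₁ refl) = xy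
  new-edge i (inj₂ (inj₁ refl)) = xa
  new-edge i (inj₂ (inj₂ refl)) = xb

IIbReduction : ∀ {m} → Graph (suc m) → (x y a b : Fin (suc m)) → Set
IIbReduction {m} G x y a b = Σ (Graph m) λ G' → Laman G' × ∃[ y' ] ∃[ a' ] ∃[ b' ]
  (punchIn x y' ≡ y × punchIn x a' ≡ a × punchIn x b' ≡ b
   × HennebergII G' G x y' a' b' × TypeIIb G' y' a' b' × Edge G' y' a' × ¬ Edge G' y' b')

old-vertex : ∀ {m} {x y : Fin (suc m)} → x ≢ y → ∃[ y' ] punchIn x y' ≡ y
old-vertex x≢y = punchOut x≢y , Fin.punchIn-punchOut x≢y

IIb-reduction : ∀ {m} {G : Graph (suc m)} → Laman G → {x y a b : Fin (suc m)} → deg G x ≡ 3 →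
  Edge G x y → Edge G x a → Edge G x b → Edge G y a → ¬ Edge G a b → ¬ Edge G y b →
  y ≢ b → a ≢ b → (∀ S → ¬ Blocking G x a b S) → IIbReduction G x y a b
IIb-reduction {m} {G} laman {x} deg≡3 xy xa xb ya ab∉G yb∉G y≢b a≢b unblocked
  with old-vertex (edge-≢ G xy) | old-vertex (edge-≢ G xa) | old-vertex (edge-≢ G xb)
... | y' , refl | a' , refl | b' , refl =
  G' , reduced-laman laman x a'≢b' deg≡3 ab∉G unblocked , y' , a' , b' , refl , refl , refl ,
  move , inj₁ (y'a'∈G' , y'b'∉G') , y'a'∈G' , y'b'∉G'
  where
  a'≢b' : a' ≢ b'
  a'≢b' = a≢b ∘ cong (punchIn x)
  G' : Graph m
  G' = addEdge (deleteVertex G x) a' b' a'≢b'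
  move : HennebergII G' G x y' a' b'
  move = reduced-move G x a'≢b'
    (degree-3-neighbours G deg≡3 xy xa xb (edge-≢ G ya) y≢b a≢b) xy xa xb ab∉G
  not-a'b' : ¬ ((y' ≡ a' × b' ≡ b') ⊎ (y' ≡ b' × b' ≡ a'))
  not-a'b' (inj₁ (refl , _)) = edge-≢ G ya refl
  not-a'b' (inj₂ (refl , _)) = y≢b refl
  y'a'∈G' : Edge G' y' a'
  y'a'∈G' = proj₁ (proj₁ (HennebergII.old move y' a') ya)
  y'b'∉G' : ¬ Edge G' y' b'
  y'b'∉G' y'b'∈G' = yb∉G (proj₂ (HennebergII.old move y' b') (y'b'∈G' , not-a'b'))

lemma3 : (m : ℕ) (G : Graph (suc m)) → Laman G →
    (u v u₁ w u₂ : Fin (suc m)) →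
    Edge G u v → Edge G v u₁ → Edge G u u₁ →
    deg G u ≡ 3 → deg G v ≡ 3 → 3 < deg G u₁ →
    w ≢ v → w ≢ u₁ → Edge G u w →
    u₂ ≢ u → u₂ ≢ u₁ → Edge G v u₂ →
    Edge G w u₂ →
    ¬ Edge G w u₁ → ¬ Edge G u₁ u₂ →
    (Σ (Graph m) λ G' → Laman G' × ∃[ u' ] ∃[ u₁' ] ∃[ u₂' ]
    (punchIn v u' ≡ u × punchIn v u₁' ≡ u₁ × punchIn v u₂' ≡ u₂
    × HennebergII G' G v u' u₁' u₂' × TypeIIb G' u' u₁' u₂'
    × Edge G' u' u₁' × ¬ Edge G' u' u₂'))
    ⊎
    (Σ (Graph m) λ G' → Laman G' × ∃[ v' ] ∃[ u₁' ] ∃[ w' ]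
    (punchIn u v' ≡ v × punchIn u u₁' ≡ u₁ × punchIn u w' ≡ w
    × HennebergII G' G u v' u₁' w' × TypeIIb G' v' u₁' w'
    × Edge G' v' u₁' × ¬ Edge G' v' w'))
lemma3 m G laman u v u₁ w u₂ uv vu₁ uu₁ deg-u deg-v _ w≢v w≢u₁ uw u₂≢u u₂≢u₁ vu₂ wu₂ wu₁∉G u₁u₂∉G =
  reduce-at-v-or-u (some-blocking? G v u₁ u₂)
  where
  u≢u₁ : u ≢ u₁
  u≢u₁ = edge-≢ G uu₁
  v≢u₁ : v ≢ u₁
  v≢u₁ = edge-≢ G vu₁
  uu₂∉G : ¬ Edge G u u₂
  uu₂∉G = not-neighbour G deg-u uv uu₁ uw v≢u₁ (w≢v ∘ sym) (w≢u₁ ∘ sym)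
    (edge-≢ G vu₂ ∘ sym) u₂≢u₁ (edge-≢ G wu₂ ∘ sym)
  vw∉G : ¬ Edge G v w
  vw∉G = not-neighbour G deg-v (edge-sym G uv) vu₁ vu₂ u≢u₁ (u₂≢u ∘ sym) (u₂≢u₁ ∘ sym)
    (edge-≢ G uw ∘ sym) w≢u₁ (edge-≢ G wu₂)
  reduce-at-v-or-u : Dec (Σ (VSet (suc m)) (Blocking G v u₁ u₂)) →
                     IIbReduction G v u u₁ u₂ ⊎ IIbReduction G u v u₁ w
  reduce-at-v-or-u (no unblocked) =
    inj₁ (IIb-reduction laman deg-v (edge-sym G uv) vu₁ vu₂ uu₁ u₁u₂∉G uu₂∉G (u₂≢u ∘ sym) (u₂≢u₁ ∘ sym)
           λ A A-blocks → unblocked (A , A-blocks))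
  reduce-at-v-or-u (yes (A , A-blocks)) =
    inj₂ (IIb-reduction laman deg-u uv uu₁ uw vu₁ (wu₁∉G ∘ edge-sym G) vw∉G (w≢v ∘ sym) (w≢u₁ ∘ sym)
           λ B B-blocks → blockers-incompatible laman uv vu₁ uu₁ uw vu₂ wu₂ (w≢v ∘ sym) (w≢u₁ ∘ sym)
                            (u₂≢u ∘ sym) (u₂≢u₁ ∘ sym) A B A-blocks B-blocks)
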